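{- Fix an integer $n\ge0$ and a row index $i$. Suppose the leftmost nonzero entry of row $i$ of $F$ is $F(x,y)=1$ and the next entry to its right is $F(x-1,y+1)=a$ with $4\le a\le 7$. Then row $i+2$ of $F$ has the same number of nonzero entries as row $i$, and the leftmost nonzero entry of row $i+2$ equals $1$.
   Context: For a fixed integer $n\ge0$, define $F:\mathbb{Z}^2\to\mathbb{Z}_{\ge0}$ by $F(0,0)=2^n$, $F(x,y)=\lfloor F(x-1,y)/2\rfloor+\lfloor F(x,y-1)/2\rfloor$ for every $(x,y)\in\mathbb{Z}_{\ge0}^2\setminus\{(0,0)\}$, and $F(x,y)=0$ for $(x,y)$ outside the first quadrant. This is the intermediate firing configuration of chip-firing on the quadrant lattice graph (vertices $\mathbb{Z}_{\ge0}^2$, edges $(x,y)\to(x+1,y)$, $(x,y)\to(x,y+1)$; a vertex with at least 2 chips fires one chip to each out-neighbour) started with $2^n$ chips at the origin and fired row by row. Row $i$ consists of the points with $x+y=i$; within a row, points are ordered left to right by increasing $y$-coordinate. -}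

module Defs where

open import Data.Nat using (ℕ; zero; suc; _+_; _∸_; _^_; _/_; _<_; _≡ᵇ_)
open import Data.List using (List; map; upTo)
open import Data.Nat.ListAction using (sum)
open import Data.Product using (∃-syntax; _×_)
open import Relation.Binary.PropositionalEquality using (_≡_)
open import Relation.Nullary using (¬_)

-- F n x y : the intermediate firing configuration on the first quadrant,
-- started with 2^n chips at the origin.  Points outside the first quadrant
-- carry 0 chips, which is implemented by the boundary clauses
-- (floor(0/2) = 0 contributions are dropped).
F : ℕ → ℕ → ℕ → ℕ
F n zero    zero    = 2 ^ n
F n (suc x) zero    = F n x zero / 2
F n zero    (suc y) = F n zero y / 2
F n (suc x) (suc y) = F n x (suc y) / 2 + F n (suc x) y / 2

nz : ℕ → ℕ
nz zero    = 0
nz (suc _) = 1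

-- row i consists of the points (i ∸ y , y) for y = 0 , … , i
-- (ordered left to right by increasing y).
rowNonzeroCount : ℕ → ℕ → ℕ
rowNonzeroCount n i = sum (map (λ y → nz (F n (i ∸ y) y)) (upTo (suc i)))

IsLeftmostNonzero : ℕ → ℕ → ℕ → ℕ → Set
IsLeftmostNonzero n i x y =
  (x + y ≡ i) × (¬ (F n x y ≡ 0)) ×
  (∀ x' y' → x' + y' ≡ i → y' < y → F n x' y' ≡ 0)

-- F is symmetric, and along each row it is nondecreasing towards the
-- diagonal: one step inwards compares two sums of halves termwise, by
-- induction.  Hence the nonzero entries of a row are exactly those between
-- its leftmost nonzero entry (x, y) and the mirror image (y, x), so the row
-- has x − y + 1 of them.  If F(x, y) = 1 then every entry of row i with
-- second coordinate at most y is at most 1, so halving wipes out that part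
-- of rows i + 1 and i + 2, while F(x + 1, y + 1) = ⌊⌊a/2⌋/2⌋ = 1.  Thus row i + 2 has
-- leftmost entry (x + 1, y + 1), which is 1, and the same width x − y + 1.
{-# OPTIONS --safe #-}
module Submission where

open import Defs
open import Data.Nat using (ℕ; zero; suc; _+_; _∸_; _≤_; _<_; _/_; z≤n; s≤s; s≤s⁻¹; z<s)
open import Data.Nat.Properties
open import Data.Nat.DivMod using (/-monoˡ-≤; m<n⇒m/n≡0)
open import Data.Nat.ListAction using (sum)
open import Data.List using (applyUpTo)
open import Data.List.Properties using (map-upTo)
open import Data.Product using (∃-syntax; _×_; _,_)
open import Data.Sum using (inj₁; inj₂; [_,_]′)
open import Relation.Nullary using (¬_; contradiction)
open import Relation.Binary.PropositionalEquality

m+n≡o+p∧n≤p⇒o≤m : ∀ {m n o p} → m + n ≡ o + p → n ≤ p → o ≤ m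
m+n≡o+p∧n≤p⇒o≤m {m} {n} {o} {p} eq n≤p =
  +-cancelʳ-≤ p o m (subst (_≤ m + p) eq (+-monoʳ-≤ m n≤p))

m+n≡o+p∧n<p⇒o<m : ∀ {m n o p} → m + n ≡ o + p → n < p → o < m
m+n≡o+p∧n<p⇒o<m {m} {n} eq = m+n≡o+p∧n≤p⇒o≤m (trans (+-suc m n) (cong suc eq))

half-mono-≤ : ∀ {m n} → m ≤ n → m / 2 ≤ n / 2
half-mono-≤ = /-monoˡ-≤ 2

≡0⇒≤1 : ∀ {m} → m ≡ 0 → m ≤ 1
≡0⇒≤1 refl = z≤n

half-≤1≡0 : ∀ {m} → m ≤ 1 → m / 2 ≡ 0
half-≤1≡0 m≤1 = m<n⇒m/n≡0 (s≤s m≤1)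

half-half-4to7≡1 : ∀ {a} → 4 ≤ a → a ≤ 7 → a / 2 / 2 ≡ 1
half-half-4to7≡1 4≤a a≤7 =
  ≤-antisym (half-mono-≤ (half-mono-≤ a≤7)) (half-mono-≤ (half-mono-≤ 4≤a))

sum-applyUpTo-interval : ∀ (f : ℕ → ℕ) {lo hi} m → lo ≤ hi → hi ≤ m →
  (∀ j → j < lo → f j ≡ 0) → (∀ j → lo ≤ j → j < hi → f j ≡ 1) →
  (∀ j → hi ≤ j → j < m → f j ≡ 0) →
  sum (applyUpTo f m) ≡ hi ∸ lo
sum-applyUpTo-interval f {zero} {zero} zero _ _ _ _ _ = refl
sum-applyUpTo-interval f {zero} {zero} (suc m) _ _ below inside above =
  cong₂ _+_ (above 0 z≤n z<s)
    (sum-applyUpTo-interval (λ j → f (suc j)) m z≤n z≤n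
      (λ _ ()) (λ _ _ ()) (λ j _ j<m → above (suc j) z≤n (s≤s j<m)))
sum-applyUpTo-interval f {zero} {suc hi} (suc m) _ (s≤s hi≤m) below inside above =
  cong₂ _+_ (inside 0 z≤n z<s)
    (sum-applyUpTo-interval (λ j → f (suc j)) m z≤n hi≤m
      (λ _ ()) (λ j _ j<hi → inside (suc j) z≤n (s≤s j<hi))
      (λ j hi≤j j<m → above (suc j) (s≤s hi≤j) (s≤s j<m)))
sum-applyUpTo-interval f {suc lo} {suc hi} (suc m) (s≤s lo≤hi) (s≤s hi≤m) below inside above =
  cong₂ _+_ (below 0 z<s)
    (sum-applyUpTo-interval (λ j → f (suc j)) m lo≤hi hi≤m
      (λ j j<lo → below (suc j) (s≤s j<lo))
      (λ j lo≤j j<hi → inside (suc j) (s≤s lo≤j) (s≤s j<hi))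
      (λ j hi≤j j<m → above (suc j) (s≤s hi≤j) (s≤s j<m)))

F-sym : ∀ n x y → F n x y ≡ F n y x
F-sym n zero    zero    = refl
F-sym n zero    (suc y) = cong (_/ 2) (F-sym n zero y)
F-sym n (suc x) zero    = cong (_/ 2) (F-sym n x zero)
F-sym n (suc x) (suc y) =
  trans (cong₂ (λ u v → u / 2 + v / 2) (F-sym n x (suc y)) (F-sym n (suc x) y))
        (+-comm (F n (suc y) x / 2) (F n y (suc x) / 2))

F-step-inward : ∀ n x y → y ≤ x → F n (suc x) y ≤ F n x (suc y)
F-step-inward n zero    zero    _ = ≤-refl
F-step-inward n (suc x) zero    _ = m≤n+m (F n (suc x) zero / 2) (F n x 1 / 2)
F-step-inward n (suc x) (suc y) (s≤s y≤x) with m≤n⇒m<n∨m≡n y≤x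
... | inj₂ refl = ≤-reflexive (F-sym n (suc (suc y)) (suc y))
... | inj₁ y<x  = +-mono-≤ (half-mono-≤ (F-step-inward n x (suc y) y<x))
                           (half-mono-≤ (F-step-inward n (suc x) y (m≤n⇒m≤1+n y≤x)))

F-slide-inward : ∀ n a b k → b + k ≤ a → F n (a + k) b ≤ F n a (b + k)
F-slide-inward n a b zero _ rewrite +-identityʳ a | +-identityʳ b = ≤-refl
F-slide-inward n a b (suc k) b+k<a rewrite +-suc a k | +-suc b k =
  ≤-trans (F-slide-inward n (suc a) b k (m≤n⇒m≤1+n (<⇒≤ b+k<a)))
          (F-step-inward n a (b + k) (<⇒≤ b+k<a))

F-inward-≤ : ∀ n {x y p q} → x + y ≡ p + q → y ≤ q → y ≤ p → F n x y ≤ F n p q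
F-inward-≤ n {x} {y} {p} {q} eq y≤q y≤p = [ towards eq y≤q , mirrored ]′ (≤-total q p)
  where
  towards : ∀ {p q} → x + y ≡ p + q → y ≤ q → q ≤ p → F n x y ≤ F n p q
  towards {p} {q} eq y≤q q≤p =
    subst₂ (λ u v → F n u y ≤ F n p v) p+k≡x y+k≡q
      (F-slide-inward n p y k (subst (_≤ p) (sym y+k≡q) q≤p))
    where
    k : ℕ
    k = q ∸ y
    y+k≡q : y + k ≡ q
    y+k≡q = m+[n∸m]≡n y≤q
    p+k≡x : p + k ≡ x
    p+k≡x = +-cancelʳ-≡ y (p + k) x (begin
      p + k + y   ≡⟨ +-assoc p k y ⟩
      p + (k + y) ≡⟨ cong (p +_) (trans (+-comm k y) y+k≡q) ⟩
      p + q       ≡⟨ sym eq ⟩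
      x + y       ∎)
      where open ≡-Reasoning

  mirrored : p ≤ q → F n x y ≤ F n p q
  mirrored p≤q = subst (F n x y ≤_) (F-sym n q p) (towards (trans eq (+-comm p q)) y≤p p≤q)

nz-≢0 : ∀ {m} → ¬ m ≡ 0 → nz m ≡ 1
nz-≢0 {zero}  m≢0 = contradiction refl m≢0
nz-≢0 {suc m} _   = refl

leftmost-y≤x : ∀ n i x y → IsLeftmostNonzero n i x y → y ≤ x
leftmost-y≤x n i x y (row , nonzero , leftZero) = ≮⇒≥ λ x<y →
  nonzero (trans (F-sym n x y) (leftZero y x (trans (+-comm y x) row) x<y))

rowNonzeroCount-leftmost : ∀ n i x y → IsLeftmostNonzero n i x y → rowNonzeroCount n i ≡ suc x ∸ y
rowNonzeroCount-leftmost n i x y leftmost@(row , nonzero , leftZero) = begin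
  rowNonzeroCount n i             ≡⟨ cong sum (map-upTo entry (suc i)) ⟩
  sum (applyUpTo entry (suc i))   ≡⟨ sum-applyUpTo-interval entry (suc i) (m≤n⇒m≤1+n y≤x) (s≤s x≤i)
                                       left middle right ⟩
  suc x ∸ y                       ∎
  where
  open ≡-Reasoning
  entry : ℕ → ℕ
  entry j = nz (F n (i ∸ j) j)
  y≤x : y ≤ x
  y≤x = leftmost-y≤x n i x y leftmost
  x≤i : x ≤ i
  x≤i = subst (x ≤_) row (m≤m+n x y)
  onRow : ∀ {j} → j ≤ i → i ∸ j + j ≡ y + x
  onRow j≤i = trans (m∸n+n≡m j≤i) (trans (sym row) (+-comm x y))

  left : ∀ j → j < y → entry j ≡ 0
  left j j<y = cong nz (leftZero (i ∸ j) j (m∸n+n≡m j≤i) j<y)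
    where
    j≤i : j ≤ i
    j≤i = ≤-trans (<⇒≤ j<y) (≤-trans y≤x x≤i)

  middle : ∀ j → y ≤ j → j < suc x → entry j ≡ 1
  middle j y≤j j<1+x = nz-≢0 λ F≡0 →
    nonzero (n≤0⇒n≡0 (subst (F n x y ≤_) F≡0 (F-inward-≤ n x+y≡ y≤j y≤i∸j)))
    where
    j≤x : j ≤ x
    j≤x = s≤s⁻¹ j<1+x
    j≤i : j ≤ i
    j≤i = ≤-trans j≤x x≤i
    x+y≡ : x + y ≡ i ∸ j + j
    x+y≡ = trans (+-comm x y) (sym (onRow j≤i))
    y≤i∸j : y ≤ i ∸ j
    y≤i∸j = m+n≡o+p∧n≤p⇒o≤m (onRow j≤i) j≤x

  right : ∀ j → suc x ≤ j → j < suc i → entry j ≡ 0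
  right j x<j j<1+i = cong nz (trans (F-sym n (i ∸ j) j)
    (leftZero j (i ∸ j) (trans (+-comm j (i ∸ j)) (m∸n+n≡m j≤i)) i∸j<y))
    where
    j≤i : j ≤ i
    j≤i = s≤s⁻¹ j<1+i
    i∸j<y : i ∸ j < y
    i∸j<y = m+n≡o+p∧n<p⇒o<m (sym (onRow j≤i)) x<j

leftmost-one⇒left-≤1 : ∀ n i x y → IsLeftmostNonzero n i x y → F n x y ≡ 1 →
  ∀ X Y → X + Y ≡ i → Y ≤ y → F n X Y ≤ 1
leftmost-one⇒left-≤1 n i x y (row , _ , leftZero) F≡1 X Y X+Y≡i Y≤y with m≤n⇒m<n∨m≡n Y≤y
... | inj₁ Y<y = ≡0⇒≤1 (leftZero X Y X+Y≡i Y<y)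
... | inj₂ refl = subst (λ u → F n u Y ≤ 1) (+-cancelʳ-≡ Y x X (trans row (sym X+Y≡i))) (≤-reflexive F≡1)

next-row-left-vanishes : ∀ n k y → (∀ X Y → X + Y ≡ k → Y ≤ y → F n X Y ≤ 1) →
  ∀ X Y → X + Y ≡ suc k → Y ≤ y → F n X Y ≡ 0
next-row-left-vanishes n k y small zero (suc Y) eq Y<y =
  half-≤1≡0 (small zero Y (suc-injective eq) (<⇒≤ Y<y))
next-row-left-vanishes n k y small (suc X) zero eq _ =
  half-≤1≡0 (small X zero (suc-injective eq) z≤n)
next-row-left-vanishes n k y small (suc X) (suc Y) eq Y<y = cong₂ _+_
  (half-≤1≡0 (small X (suc Y) (suc-injective eq) Y<y))
  (half-≤1≡0 (small (suc X) Y (trans (sym (+-suc X Y)) (suc-injective eq)) (<⇒≤ Y<y)))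

F-right₂-≡-quarter : ∀ n x y → F n (suc x) y ≤ 1 → F n (suc (suc x)) y ≤ 1 →
  F n (suc (suc x)) (suc y) ≡ F n x (suc y) / 2 / 2
F-right₂-≡-quarter n x y small₁ small₂ = begin
  (F n x (suc y) / 2 + F n (suc x) y / 2) / 2 + F n (suc (suc x)) y / 2
    ≡⟨ cong₂ (λ u v → (F n x (suc y) / 2 + u) / 2 + v) (half-≤1≡0 small₁) (half-≤1≡0 small₂) ⟩
  (F n x (suc y) / 2 + 0) / 2 + 0
    ≡⟨ +-identityʳ ((F n x (suc y) / 2 + 0) / 2) ⟩
  (F n x (suc y) / 2 + 0) / 2
    ≡⟨ cong (_/ 2) (+-identityʳ (F n x (suc y) / 2)) ⟩
  F n x (suc y) / 2 / 2
    ∎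
  where open ≡-Reasoning

proposition6p4 : (n i x y a : ℕ) →
    IsLeftmostNonzero n i x y → F n x y ≡ 1 →
    1 ≤ x → F n (x ∸ 1) (suc y) ≡ a → 4 ≤ a → a ≤ 7 →
    (rowNonzeroCount n (i + 2) ≡ rowNonzeroCount n i) ×
    (∃[ x' ] ∃[ y' ] (IsLeftmostNonzero n (i + 2) x' y' × F n x' y' ≡ 1))
proposition6p4 n i (suc x) y a leftmost@(row , _ , _) F≡1 (s≤s z≤n) F≡a 4≤a a≤7 =
  trans (rowNonzeroCount-leftmost n (i + 2) (suc (suc x)) (suc y) leftmost₂)
        (sym (rowNonzeroCount-leftmost n i (suc x) y leftmost))
  , suc (suc x) , suc y , leftmost₂ , F₂≡1
  where
  open ≡-Reasoning

  row₀-left-≤1 : ∀ X Y → X + Y ≡ i → Y ≤ y → F n X Y ≤ 1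
  row₀-left-≤1 = leftmost-one⇒left-≤1 n i (suc x) y leftmost F≡1

  row₁-left-≡0 : ∀ X Y → X + Y ≡ suc i → Y ≤ y → F n X Y ≡ 0
  row₁-left-≡0 = next-row-left-vanishes n i y row₀-left-≤1

  row₂-left-≡0 : ∀ X Y → X + Y ≡ suc (suc i) → Y ≤ y → F n X Y ≡ 0
  row₂-left-≡0 = next-row-left-vanishes n (suc i) y λ X Y eq Y≤y → ≡0⇒≤1 (row₁-left-≡0 X Y eq Y≤y)

  F₂≡1 : F n (suc (suc x)) (suc y) ≡ 1
  F₂≡1 = begin
    F n (suc (suc x)) (suc y) ≡⟨ F-right₂-≡-quarter n x y (≤-reflexive F≡1)
                                   (≡0⇒≤1 (row₁-left-≡0 (suc (suc x)) y (cong suc row) ≤-refl)) ⟩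
    F n x (suc y) / 2 / 2     ≡⟨ cong (λ b → b / 2 / 2) F≡a ⟩
    a / 2 / 2                 ≡⟨ half-half-4to7≡1 4≤a a≤7 ⟩
    1                         ∎

  i+2≡2+i : i + 2 ≡ suc (suc i)
  i+2≡2+i = +-comm i 2

  leftmost₂ : IsLeftmostNonzero n (i + 2) (suc (suc x)) (suc y)
  leftmost₂ = trans (cong (λ m → suc (suc m)) (trans (+-suc x y) row)) (sym i+2≡2+i)
            , (λ F≡0 → 1+n≢0 (trans (sym F₂≡1) F≡0))
            , λ X Y eq Y<1+y → row₂-left-≡0 X Y (trans eq i+2≡2+i) (s≤s⁻¹ Y<1+y)
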